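{- Let $e_1,e_2,e_3$ be edges of a digraph $G$. If $(e_1,e_2)$ and $(e_2,e_3)$ are SESE regions, then so is $(e_1,e_3)$.
   Context: All digraphs are finite; loops allowed, no multiple edges. A vertex is a source if it has no incoming non-loop edge and a target if it has no outgoing non-loop edge. For edges $x,y$: $x \text{ dom } y$ iff every path from a source of $G$ traversing $y$ passes through $x$; $y \text{ pdom } x$ iff every path from $x$ to a target of $G$ traverses $y$ (dominance in the reversed digraph). A SESE region is an ordered pair of edges $(e_1,e_2)$ with $e_1 \text{ dom } e_2$, $e_2 \text{ pdom } e_1$, and such that a cycle in $G$ contains $e_1$ iff it contains $e_2$ (pairs $(e,e)$ are allowed and are SESE regions). -}

module Defs where

open import Data.Nat using (ℕ)
open import Data.Fin using (Fin)
open import Data.Product using (Σ; _×_; _,_)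
open import Data.Sum using (_⊎_)
open import Relation.Binary.PropositionalEquality using (_≡_)
open import Relation.Nullary using (¬_)
open import Level using (0ℓ; suc)

-- A finite digraph: vertex set Fin n, adjacency relation (loops allowed;
-- no multiple edges, since an edge is determined by its endpoints).
record Digraph : Set₁ where
  field
    n   : ℕ
    Adj : Fin n → Fin n → Set

module _ (G : Digraph) where
  open Digraph G

  V : Set
  V = Fin n

  record Edge : Set where
    constructor edge
    field
      src : V
      tgt : V
      adj : Adj src tgt
  open Edge public

  IsSource : V → Set
  IsSource v = ∀ u → Adj u v → u ≡ v

  IsTarget : V → Set
  IsTarget v = ∀ w → Adj v w → w ≡ v

  data Walk : V → V → Set where
    []  : ∀ {v} → Walk v v
    _∷_ : ∀ {u v w} → Adj u v → Walk v w → Walk u w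

  _▷_ : ∀ {u v w} → Walk u v → Adj v w → Walk u w
  [] ▷ a = a ∷ []
  (b ∷ p) ▷ a = b ∷ (p ▷ a)

  data Traverses : ∀ {u w} → Walk u w → Edge → Set where
    here  : ∀ {u v w} (a : Adj u v) (p : Walk v w) {e : Edge} →
            src e ≡ u → tgt e ≡ v → Traverses (a ∷ p) e
    there : ∀ {u v w} (a : Adj u v) (p : Walk v w) {e : Edge} →
            Traverses p e → Traverses (a ∷ p) e

  Dom : Edge → Edge → Set
  Dom x y = ∀ s → IsSource s → (p : Walk s (src y)) → Traverses (p ▷ adj y) x

  PDom : Edge → Edge → Set
  PDom y x = ∀ t → IsTarget t → (p : Walk (tgt x) t) → Traverses (adj x ∷ p) y

  record Cycle : Set where
    constructor cycle
    field
      {base next} : V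
      first : Adj base next
      rest  : Walk next base

  InCycle : Cycle → Edge → Set
  InCycle c e = Traverses (Cycle.first c ∷ Cycle.rest c) e

  record SESE (e₁ e₂ : Edge) : Set where
    field
      dom   : Dom e₁ e₂
      pdom  : PDom e₂ e₁
      cyc⇒  : ∀ (c : Cycle) → InCycle c e₁ → InCycle c e₂
      cyc⇐  : ∀ (c : Cycle) → InCycle c e₂ → InCycle c e₁

-- Dominance composes: a walk from a source through e₃ passes through e₂, and
-- cutting it just after e₂ gives a walk from the source through e₂, which must
-- pass through e₁; since that cut walk is part of the original one, so does it.
-- Post-dominance is symmetric (cut just before e₂), and the cycle condition is
-- an equivalence, hence transitive.
module Submission where

open import Defs
open import Data.Product using (Σ; _,_)
open import Relation.Binary.PropositionalEquality using (refl)
open import Function using (_∘_)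

module _ {G : Digraph} where

  _⊆ᵀ_ : ∀ {u w u′ w′} → Walk G u w → Walk G u′ w′ → Set
  p ⊆ᵀ r = ∀ {x} → Traverses G p x → Traverses G r x

  prefix-through : ∀ {u w} {r : Walk G u w} e → Traverses G r e →
                   Σ (Walk G u (src e)) λ p → _▷_ G p (adj e) ⊆ᵀ r
  prefix-through (edge _ _ _) (here a q refl refl) = [] , λ where
    (here _ _ s≡ t≡) → here a q s≡ t≡
    (there _ _ ())
  prefix-through e (there a q tr) with prefix-through e tr
  ... | p , p⊆q = a ∷ p , λ where
    (here _ _ s≡ t≡) → here a q s≡ t≡
    (there _ _ tx)   → there a q (p⊆q tx)

  suffix-from : ∀ {u w} {r : Walk G u w} e → Traverses G r e →
                Σ (Walk G (tgt e) w) λ q → (adj e ∷ q) ⊆ᵀ r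
  suffix-from (edge _ _ _) (here a q refl refl) = q , λ where
    (here _ _ s≡ t≡) → here a q s≡ t≡
    (there _ _ tx)   → there a q tx
  suffix-from e (there a q tr) with suffix-from e tr
  ... | q′ , q′⊆q = q′ , λ tx → there a q (q′⊆q tx)

  Dom-trans : ∀ {x y z} → Dom G x y → Dom G y z → Dom G x z
  Dom-trans {y = y} x-dom-y y-dom-z s s-source p
    with prefix-through y (y-dom-z s s-source p)
  ... | p′ , p′⊆p = p′⊆p (x-dom-y s s-source p′)

  PDom-trans : ∀ {x y z} → PDom G z y → PDom G y x → PDom G z x
  PDom-trans {y = y} z-pdom-y y-pdom-x t t-target q
    with suffix-from y (y-pdom-x t t-target q)
  ... | q′ , q′⊆q = q′⊆q (z-pdom-y t t-target q′)

mainTheorem7 : (G : Digraph) (e₁ e₂ e₃ : Edge G) →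
    SESE G e₁ e₂ → SESE G e₂ e₃ → SESE G e₁ e₃
mainTheorem7 G e₁ e₂ e₃ r₁₂ r₂₃ = record
  { dom  = Dom-trans (SESE.dom r₁₂) (SESE.dom r₂₃)
  ; pdom = PDom-trans (SESE.pdom r₂₃) (SESE.pdom r₁₂)
  ; cyc⇒ = λ c → SESE.cyc⇒ r₂₃ c ∘ SESE.cyc⇒ r₁₂ c
  ; cyc⇐ = λ c → SESE.cyc⇐ r₁₂ c ∘ SESE.cyc⇐ r₂₃ c
  }
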